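{- For every integer $d\geq 3$, $\alpha(G(d^2,d))=\frac{d^2-d}{2}$.
   Context: For integers $n\geq 1$, $d\geq 3$, the recursive circulant graph $G(d^n,d)$ has vertex set $\{0,1,\dots,d^n-1\}$, with $u,v$ adjacent iff $u-v\equiv \pm d^i\pmod{d^n}$ for some $0\leq i\leq n-1$. $\alpha$ denotes the independence number. -}

module Defs where

open import Data.Nat using (ℕ; _^_; _<_; _≤_)
open import Data.Integer using (ℤ; +_; _-_; _+_)
open import Data.Integer.Divisibility using (_∣_)
open import Data.Fin using (Fin; toℕ)
open import Data.Fin.Subset using (Subset; _∈_; ∣_∣)
open import Data.Product using (Σ; ∃; _×_)
open import Data.Sum using (_⊎_)
open import Relation.Nullary using (¬_)
open import Relation.Binary.PropositionalEquality using (_≡_)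

-- Adjacency in the recursive circulant graph G(d^n, d):
-- vertices are 0 .. d^n - 1 (as Fin (d ^ n)); u ~ v iff
-- u - v ≡ ± d^i (mod d^n) for some 0 ≤ i ≤ n - 1.
RCAdj : (n d : ℕ) → Fin (d ^ n) → Fin (d ^ n) → Set
RCAdj n d u v =
  Σ ℕ λ i → (i < n) ×
    ( ((+ (d ^ n)) ∣ ((+ toℕ u - + toℕ v) - + (d ^ i)))
    ⊎ ((+ (d ^ n)) ∣ ((+ toℕ u - + toℕ v) + + (d ^ i))) )

Independent : {N : ℕ} → (Fin N → Fin N → Set) → Subset N → Set
Independent {N} Adj S = ∀ (u v : Fin N) → u ∈ S → v ∈ S → ¬ Adj u v

IsIndependenceNumber : {N : ℕ} → (Fin N → Fin N → Set) → ℕ → Set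
IsIndependenceNumber {N} Adj k =
  (∃ λ (S : Subset N) → Independent Adj S × ∣ S ∣ ≡ k)
  × (∀ (S : Subset N) → Independent Adj S → ∣ S ∣ ≤ k)

-- G(d², d) is the circulant graph on ℤ/d²ℤ with steps ±1 and ±d. For the upper bound, every
-- translate of a suitable odd cycle of length 2k + 1 meets an independent set S in at most k
-- vertices: x, x + 1, …, x + d, closed by the step d, when d = 2k is even, and x, x + d, …, x + 2kd,
-- closed by wrapping around, when d = 2k + 1 is odd. Averaging over the d² translates gives
-- (2k + 1)|S| ≤ d²k, that is |S| ≤ (d² − d)/2. For the lower bound, when d is odd the even vertices
-- below d² − d are independent; when d is even a set periodic modulo 2d works: of the residues
-- modulo 2d take the even ones below d and the odd ones from d to 2d − 3.
module Submission where

open import Data.Bool using (Bool; true; false; T; not; _∧_; _xor_)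
open import Data.Bool.Properties
  using (T-≡; T-∧; not-involutive; not-distribˡ-xor; not-distribʳ-xor; xor-same; xor-comm; xor-identityʳ;
         ∧-identityʳ; ∧-zeroʳ)
open import Data.Empty using (⊥; ⊥-elim)
open import Data.Fin using (Fin; toℕ; fromℕ<)
open import Data.Fin.Properties using (toℕ-fromℕ<; toℕ<n)
open import Data.Fin.Subset using (Subset; _∈_; ∣_∣)
open import Data.Integer as ℤ using (_⊖_)
import Data.Integer.Divisibility as ℤ
open import Data.Integer.Properties using (pos-+; [+m]-[+n]≡m⊖n; ∣m⊖n∣≡∣n⊖m∣; ∣⊖∣-≤)
open import Data.Integer.Tactic.RingSolver using () renaming (solve-∀ to ℤ-solve-∀)
open import Data.Nat
open import Data.Nat.DivMod
open import Data.Nat.Divisibility using (_∣_; divides; n∣m*n)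
open import Data.Nat.Properties
open import Data.Nat.Tactic.RingSolver using (solve-∀)
open import Data.Product using (Σ; _×_; _,_; proj₁; proj₂)
open import Data.Sum using (_⊎_; inj₁; inj₂; [_,_]′)
open import Data.Vec using (Vec; []; _∷_; lookup; tabulate)
open import Data.Vec.Properties using (lookup⇒[]=; []=⇒lookup; lookup∘tabulate)
open import Function.Base using (_∘_)
open import Function.Bundles using (Equivalence)
open import Relation.Binary.PropositionalEquality
open import Relation.Nullary using (¬_; yes; no)
open import Relation.Nullary.Decidable using (dec-true; dec-false)

open import Defs

∑< : ℕ → (ℕ → ℕ) → ℕ
∑< zero    f = 0
∑< (suc n) f = f 0 + ∑< n (λ x → f (suc x))

syntax ∑< n (λ x → e) = ∑[ x < n ] e

∑-cong : ∀ n {f g : ℕ → ℕ} → (∀ x → x < n → f x ≡ g x) → ∑< n f ≡ ∑< n g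
∑-cong zero    eq = refl
∑-cong (suc n) eq = cong₂ _+_ (eq 0 z<s) (∑-cong n λ x x<n → eq (suc x) (s<s x<n))

∑-mono : ∀ n {f g : ℕ → ℕ} → (∀ x → x < n → f x ≤ g x) → ∑< n f ≤ ∑< n g
∑-mono zero    le = z≤n
∑-mono (suc n) le = +-mono-≤ (le 0 z<s) (∑-mono n λ x x<n → le (suc x) (s<s x<n))

∑-const : ∀ n c → ∑[ _ < n ] c ≡ n * c
∑-const zero    c = refl
∑-const (suc n) c = cong (c +_) (∑-const n c)

∑-last : ∀ n f → ∑< (suc n) f ≡ ∑< n f + f n
∑-last zero    f = +-comm (f 0) 0
∑-last (suc n) f = trans (cong (f 0 +_) (∑-last n λ x → f (suc x))) (sym (+-assoc (f 0) _ _))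

∑-split : ∀ m n f → ∑< (m + n) f ≡ ∑< m f + ∑[ x < n ] f (m + x)
∑-split zero    n f = refl
∑-split (suc m) n f = trans (cong (f 0 +_) (∑-split m n λ x → f (suc x))) (sym (+-assoc (f 0) _ _))

∑-distrib-+ : ∀ n f g → ∑[ x < n ] (f x + g x) ≡ ∑< n f + ∑< n g
∑-distrib-+ zero    f g = refl
∑-distrib-+ (suc n) f g = trans (cong (f 0 + g 0 +_) (∑-distrib-+ n _ _)) (interchange (f 0) (g 0) _ _)
  where
  interchange : ∀ a b c d → a + b + (c + d) ≡ a + c + (b + d)
  interchange = solve-∀

∑-comm : ∀ m n (F : ℕ → ℕ → ℕ) → ∑[ x < m ] ∑< n (F x) ≡ ∑[ y < n ] ∑[ x < m ] F x y
∑-comm zero    n F = trans (sym (*-zeroʳ n)) (sym (∑-const n 0))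
∑-comm (suc m) n F = trans (cong (∑< n (F 0) +_) (∑-comm m n λ x → F (suc x))) (sym (∑-distrib-+ n (F 0) _))

∑-rotate : ∀ N c (h : ℕ → ℕ) → (∀ y → h (y + N) ≡ h y) → ∑[ x < N ] h (x + c) ≡ ∑< N h
∑-rotate N zero    h per = ∑-cong N λ x _ → cong h (+-identityʳ x)
∑-rotate N (suc c) h per = begin
  ∑[ x < N ] h (x + suc c)  ≡⟨ ∑-cong N (λ x _ → cong h (+-suc x c)) ⟩
  ∑[ x < N ] h (suc x + c)  ≡⟨ +-cancelʳ-≡ (h c) _ _ rotate-once ⟩
  ∑[ x < N ] h (x + c)      ≡⟨ ∑-rotate N c h per ⟩
  ∑< N h                    ∎
  where
  open ≡-Reasoning
  rotate-once : ∑[ x < N ] h (suc x + c) + h c ≡ ∑[ x < N ] h (x + c) + h c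
  rotate-once = begin
    ∑[ x < N ] h (suc x + c) + h c    ≡⟨ +-comm _ (h c) ⟩
    ∑[ x < suc N ] h (x + c)          ≡⟨ ∑-last N (λ x → h (x + c)) ⟩
    ∑[ x < N ] h (x + c) + h (N + c)  ≡⟨ cong (λ y → ∑[ x < N ] h (x + c) + h y) (+-comm N c) ⟩
    ∑[ x < N ] h (x + c) + h (c + N)  ≡⟨ cong (∑[ x < N ] h (x + c) +_) (per c) ⟩
    ∑[ x < N ] h (x + c) + h c        ∎

∑-periodic : ∀ k D (f : ℕ → ℕ) → (∀ y → f (D + y) ≡ f y) → ∑< (k * D) f ≡ k * ∑< D f
∑-periodic zero    D f per = refl
∑-periodic (suc k) D f per = begin
  ∑< (D + k * D) f                   ≡⟨ ∑-split D (k * D) f ⟩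
  ∑< D f + ∑[ x < k * D ] f (D + x)  ≡⟨ cong (∑< D f +_) (∑-cong (k * D) λ x _ → per x) ⟩
  ∑< D f + ∑< (k * D) f              ≡⟨ cong (∑< D f +_) (∑-periodic k D f per) ⟩
  ∑< D f + k * ∑< D f                ∎
  where open ≡-Reasoning

-- Odd cycles

-- Summing c j + c (suc j) ≤ 1 over the m edges of the path counts every inner vertex twice.
∑-along-path : ∀ m (c : ℕ → ℕ) → (∀ j → j < m → c j + c (suc j) ≤ 1) →
               2 * ∑[ j < suc m ] c j ≤ m + c 0 + c m
∑-along-path zero    c edge = ≤-reflexive (double (c 0))
  where
  double : ∀ a → 2 * (a + 0) ≡ a + a
  double = solve-∀
∑-along-path (suc m) c edge = begin
  2 * (c 0 + ∑[ j < suc m ] c′ j)      ≡⟨ distrib (c 0) _ ⟩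
  c 0 + c 0 + 2 * ∑[ j < suc m ] c′ j  ≤⟨ +-monoʳ-≤ (c 0 + c 0) (∑-along-path m c′ λ j j<m → edge (suc j) (s<s j<m)) ⟩
  c 0 + c 0 + (m + c 1 + c (suc m))    ≡⟨ regroup (c 0) (c 1) m (c (suc m)) ⟩
  c 0 + c 1 + (m + c 0 + c (suc m))    ≤⟨ +-monoˡ-≤ _ (edge 0 z<s) ⟩
  suc m + c 0 + c (suc m)              ∎
  where
  open ≤-Reasoning
  c′ : ℕ → ℕ
  c′ j = c (suc j)
  distrib : ∀ a s → 2 * (a + s) ≡ a + a + 2 * s
  distrib = solve-∀
  regroup : ∀ a b m z → a + a + (m + b + z) ≡ a + b + (m + a + z)
  regroup = solve-∀

≤-from-scaled-bound : ∀ L {s m M} → L * s ≤ M → M < L * suc m → s ≤ m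
≤-from-scaled-bound L Ls≤M M<L[1+m] = <⇒≤pred (*-cancelˡ-< L _ _ (≤-<-trans Ls≤M M<L[1+m]))

∑-around-oddCycle : ∀ k (c : ℕ → ℕ) → (∀ j → j < k + k → c j + c (suc j) ≤ 1) → c 0 + c (k + k) ≤ 1 →
                    ∑[ j < suc (k + k) ] c j ≤ k
∑-around-oddCycle k c edge closing = ≤-from-scaled-bound 2 (begin
  2 * ∑[ j < suc (k + k) ] c j  ≤⟨ ∑-along-path (k + k) c edge ⟩
  k + k + c 0 + c (k + k)       ≡⟨ +-assoc (k + k) _ _ ⟩
  k + k + (c 0 + c (k + k))     ≤⟨ +-monoʳ-≤ (k + k) closing ⟩
  k + k + 1                     ∎) (≤-reflexive (twice-suc k))
  where
  open ≤-Reasoning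
  twice-suc : ∀ k → suc (k + k + 1) ≡ 2 * suc k
  twice-suc = solve-∀

-- Double counting: every residue lies on 2k + 1 of the N cycles x, x + t, …, x + 2kt with x < N.
∑-periodic-oddCycles : ∀ N t k (h : ℕ → ℕ) → (∀ y → h (y + N) ≡ h y) →
                       (∀ y → h y + h (y + t) ≤ 1) → (∀ y → h y + h (y + (k + k) * t) ≤ 1) →
                       suc (k + k) * ∑< N h ≤ N * k
∑-periodic-oddCycles N t k h per edge closing = begin
  L * ∑< N h                           ≡⟨ ∑-const L (∑< N h) ⟨
  ∑[ _ < L ] ∑< N h                    ≡⟨ ∑-cong L (λ j _ → ∑-rotate N (j * t) h per) ⟨
  ∑[ j < L ] ∑[ x < N ] h (x + j * t)  ≡⟨ ∑-comm N L (λ x j → h (x + j * t)) ⟨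
  ∑[ x < N ] ∑[ j < L ] h (x + j * t)  ≤⟨ ∑-mono N (λ x _ → cycle-through x) ⟩
  ∑[ _ < N ] k                         ≡⟨ ∑-const N k ⟩
  N * k                                ∎
  where
  open ≤-Reasoning
  L = suc (k + k)
  next : ∀ x j t → x + j * t + t ≡ x + suc j * t
  next = solve-∀
  cycle-through : ∀ x → ∑[ j < L ] h (x + j * t) ≤ k
  cycle-through x = ∑-around-oddCycle k (λ j → h (x + j * t))
    (λ j _ → subst (λ y → h (x + j * t) + h y ≤ 1) (next x j t) (edge (x + j * t)))
    (subst (λ y → h y + h (x + (k + k) * t) ≤ 1) (sym (+-identityʳ x)) (closing x))

𝟙 : Bool → ℕ
𝟙 true  = 1
𝟙 false = 0

𝟙≤1 : ∀ b → 𝟙 b ≤ 1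
𝟙≤1 true  = ≤-refl
𝟙≤1 false = z≤n

𝟙-exclusive : ∀ {a b} → (T a → T b → ⊥) → 𝟙 a + 𝟙 b ≤ 1
𝟙-exclusive {true}  {true}  excl = ⊥-elim (excl _ _)
𝟙-exclusive {true}  {false} excl = ≤-refl
𝟙-exclusive {false} {b}     excl = 𝟙≤1 b

𝟙-not : ∀ b → 𝟙 b + 𝟙 (not b) ≡ 1
𝟙-not true  = refl
𝟙-not false = refl

T⇒¬T-not : ∀ {b} → T b → ¬ T (not b)
T⇒¬T-not {true} _ ()

oddᵇ : ℕ → Bool
oddᵇ zero    = false
oddᵇ (suc n) = not (oddᵇ n)

oddᵇ-+ : ∀ m n → oddᵇ (m + n) ≡ oddᵇ m xor oddᵇ n
oddᵇ-+ zero    n = refl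
oddᵇ-+ (suc m) n = trans (cong not (oddᵇ-+ m n)) (not-distribˡ-xor (oddᵇ m) (oddᵇ n))

oddᵇ-double : ∀ e → oddᵇ (e + e) ≡ false
oddᵇ-double e = trans (oddᵇ-+ e e) (xor-same (oddᵇ e))

∑-alternating : ∀ e f → (∀ x → f x + f (suc x) ≡ 1) → ∑< (e + e) f ≡ e
∑-alternating zero    f alt = refl
∑-alternating (suc e) f alt = begin
  ∑< (suc e + suc e) f                    ≡⟨ cong (λ m → ∑< (suc m) f) (+-suc e e) ⟩
  f 0 + (f 1 + ∑[ x < e + e ] f (2 + x))  ≡⟨ +-assoc (f 0) _ _ ⟨
  f 0 + f 1 + ∑[ x < e + e ] f (2 + x)    ≡⟨ cong₂ _+_ (alt 0) (∑-alternating e (f ∘ (2 +_)) (alt ∘ (2 +_))) ⟩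
  suc e                                   ∎
  where open ≡-Reasoning

∑-evens : ∀ e → ∑[ x < e + e ] 𝟙 (not (oddᵇ x)) ≡ e
∑-evens e = ∑-alternating e _ λ x → 𝟙-not (not (oddᵇ x))

∑-odds : ∀ e → ∑[ x < e + e ] 𝟙 (oddᵇ x) ≡ e
∑-odds e = ∑-alternating e _ λ x → 𝟙-not (oddᵇ x)

data Halves : ℕ → Set where
  even : ∀ e → Halves (e + e)
  odd  : ∀ e → Halves (suc (e + e))

halves : ∀ n → Halves n
halves zero = even 0
halves (suc n) with halves n
... | even e = odd e
... | odd e  = subst Halves (cong suc (+-suc e e)) (even (suc e))

-- Recursive circulant graphs

%≡%-from-∣∸ : ∀ {m n} N .{{_ : NonZero N}} → n ≤ m → N ∣ m ∸ n → m % N ≡ n % N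
%≡%-from-∣∸ {m} {n} N n≤m N∣m∸n = begin
  m % N              ≡⟨ cong (_% N) (m+[n∸m]≡n n≤m) ⟨
  (n + (m ∸ n)) % N  ≡⟨ %-remove-+ʳ n N∣m∸n ⟩
  n % N              ∎
  where open ≡-Reasoning

∣⊖∣⇒%≡% : ∀ m n N .{{_ : NonZero N}} → N ∣ ℤ.∣ m ⊖ n ∣ → m % N ≡ n % N
∣⊖∣⇒%≡% m n N N∣∣m⊖n∣ with ≤-total n m
... | inj₁ n≤m = %≡%-from-∣∸ N n≤m (subst (N ∣_) (trans (∣m⊖n∣≡∣n⊖m∣ m n) (∣⊖∣-≤ n≤m)) N∣∣m⊖n∣)
... | inj₂ m≤n = sym (%≡%-from-∣∸ N m≤n (subst (N ∣_) (∣⊖∣-≤ m≤n) N∣∣m⊖n∣))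

∣-⇒%≡% : ∀ m n N .{{_ : NonZero N}} → ℤ.+ N ℤ.∣ ℤ.+ m ℤ.- ℤ.+ n → m % N ≡ n % N
∣-⇒%≡% m n N = ∣⊖∣⇒%≡% m n N ∘ subst (λ i → N ∣ ℤ.∣ i ∣) ([+m]-[+n]≡m⊖n m n)

∣%-difference : ∀ m N .{{_ : NonZero N}} → ℤ.+ N ℤ.∣ ℤ.+ (m % N) ℤ.- ℤ.+ m
∣%-difference m N = subst (N ∣_) (sym ∣m%N-m∣) (n∣m*n (m / N))
  where
  open ≡-Reasoning
  ∣m%N-m∣ : ℤ.∣ ℤ.+ (m % N) ℤ.- ℤ.+ m ∣ ≡ m / N * N
  ∣m%N-m∣ = begin
    ℤ.∣ ℤ.+ (m % N) ℤ.- ℤ.+ m ∣    ≡⟨ cong ℤ.∣_∣ ([+m]-[+n]≡m⊖n (m % N) m) ⟩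
    ℤ.∣ m % N ⊖ m ∣            ≡⟨ ∣⊖∣-≤ (m%n≤m m N) ⟩
    m ∸ m % N                  ≡⟨ cong (_∸ m % N) (m≡m%n+[m/n]*n m N) ⟩
    m % N + m / N * N ∸ m % N  ≡⟨ m+n∸m≡n (m % N) _ ⟩
    m / N * N                  ∎

[a-b]-c≡a-[b+c] : ∀ a b c → (ℤ.+ a ℤ.- ℤ.+ b) ℤ.- ℤ.+ c ≡ ℤ.+ a ℤ.- ℤ.+ (b + c)
[a-b]-c≡a-[b+c] a b c = trans (ring (ℤ.+ a) (ℤ.+ b) (ℤ.+ c)) (cong (λ i → ℤ.+ a ℤ.- i) (sym (pos-+ b c)))
  where
  ring : ∀ a b c → (a ℤ.- b) ℤ.- c ≡ a ℤ.- (b ℤ.+ c)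
  ring = ℤ-solve-∀

[a-b]+c≡[a+c]-b : ∀ a b c → (ℤ.+ a ℤ.- ℤ.+ b) ℤ.+ ℤ.+ c ≡ ℤ.+ (a + c) ℤ.- ℤ.+ b
[a-b]+c≡[a+c]-b a b c = trans (ring (ℤ.+ a) (ℤ.+ b) (ℤ.+ c)) (cong (ℤ._- ℤ.+ b) (sym (pos-+ a c)))
  where
  ring : ∀ a b c → (a ℤ.- b) ℤ.+ c ≡ (a ℤ.+ c) ℤ.- b
  ring = ℤ-solve-∀

∣[[m+t]%N-m]-t : ∀ m t N .{{_ : NonZero N}} → ℤ.+ N ℤ.∣ (ℤ.+ ((m + t) % N) ℤ.- ℤ.+ m) ℤ.- ℤ.+ t
∣[[m+t]%N-m]-t m t N = subst (ℤ.+ N ℤ.∣_) (sym ([a-b]-c≡a-[b+c] ((m + t) % N) m t)) (∣%-difference (m + t) N)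

∣[a-b]-t⇒a≡[b+t]%N : ∀ a b t {N} .{{_ : NonZero N}} → a < N → ℤ.+ N ℤ.∣ (ℤ.+ a ℤ.- ℤ.+ b) ℤ.- ℤ.+ t →
                     a ≡ (b + t) % N
∣[a-b]-t⇒a≡[b+t]%N a b t {N} a<N N∣ =
  trans (sym (m<n⇒m%n≡m a<N)) (∣-⇒%≡% a (b + t) N (subst (ℤ.+ N ℤ.∣_) ([a-b]-c≡a-[b+c] a b t) N∣))

∣[a-b]+t⇒b≡[a+t]%N : ∀ a b t {N} .{{_ : NonZero N}} → b < N → ℤ.+ N ℤ.∣ (ℤ.+ a ℤ.- ℤ.+ b) ℤ.+ ℤ.+ t →
                     b ≡ (a + t) % N
∣[a-b]+t⇒b≡[a+t]%N a b t {N} b<N N∣ =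
  sym (trans (∣-⇒%≡% (a + t) b N (subst (ℤ.+ N ℤ.∣_) ([a-b]+c≡[a+c]-b a b t) N∣)) (m<n⇒m%n≡m b<N))

%-absorbˡ-+ : ∀ m n N .{{_ : NonZero N}} → (m + n) % N ≡ (m % N + n) % N
%-absorbˡ-+ m n N = begin
  (m + n) % N              ≡⟨ %-distribˡ-+ m n N ⟩
  (m % N + n % N) % N      ≡⟨ cong (λ k → (k + n % N) % N) (m%n%n≡m%n m N) ⟨
  (m % N % N + n % N) % N  ≡⟨ %-distribˡ-+ (m % N) n N ⟨
  (m % N + n) % N          ∎
  where open ≡-Reasoning

lookupℕ : ∀ {N} → Vec Bool N → ℕ → Bool
lookupℕ []       _       = false
lookupℕ (b ∷ bs) zero    = b
lookupℕ (b ∷ bs) (suc x) = lookupℕ bs x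

lookup-fromℕ< : ∀ {N} (S : Vec Bool N) {x} .(x<N : x < N) → lookup S (fromℕ< x<N) ≡ lookupℕ S x
lookup-fromℕ< (b ∷ S) {zero}  x<N = refl
lookup-fromℕ< (b ∷ S) {suc x} x<N = lookup-fromℕ< S (≤-pred x<N)

∣S∣≡∑lookupℕ : ∀ {N} (S : Subset N) → ∣ S ∣ ≡ ∑[ x < N ] 𝟙 (lookupℕ S x)
∣S∣≡∑lookupℕ []          = refl
∣S∣≡∑lookupℕ (true ∷ S)  = cong suc (∣S∣≡∑lookupℕ S)
∣S∣≡∑lookupℕ (false ∷ S) = ∣S∣≡∑lookupℕ S

module _ {N : ℕ} .{{_ : NonZero N}} where

  χ : Subset N → ℕ → ℕ
  χ S y = 𝟙 (lookupℕ S (y % N))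

  χ-periodic : ∀ S y → χ S (y + N) ≡ χ S y
  χ-periodic S y = cong (𝟙 ∘ lookupℕ S) ([m+n]%n≡m%n y N)

  ∣S∣≡∑χ : ∀ S → ∣ S ∣ ≡ ∑< N (χ S)
  ∣S∣≡∑χ S = trans (∣S∣≡∑lookupℕ S) (∑-cong N λ x x<N → cong (𝟙 ∘ lookupℕ S) (sym (m<n⇒m%n≡m x<N)))

  χ-member : ∀ S {y} → T (lookupℕ S (y % N)) → fromℕ< (m%n<n y N) ∈ S
  χ-member S {y} y∈S = lookup⇒[]= _ S (trans (lookup-fromℕ< S (m%n<n y N)) (Equivalence.to T-≡ y∈S))

  select : (ℕ → Bool) → Subset N
  select P = tabulate (P ∘ toℕ)

  ∈-select : ∀ P {u} → u ∈ select P → T (P (toℕ u))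
  ∈-select P {u} u∈ = Equivalence.from T-≡ (trans (sym (lookup∘tabulate _ u)) ([]=⇒lookup u∈))

  ∣select∣ : ∀ P → ∣ select P ∣ ≡ ∑[ x < N ] 𝟙 (P x)
  ∣select∣ P = trans (∣S∣≡∑lookupℕ (select P)) (∑-cong N λ x x<N → cong 𝟙 (begin
    lookupℕ (select P) x            ≡⟨ lookup-fromℕ< (select P) x<N ⟨
    lookup (select P) (fromℕ< x<N)  ≡⟨ lookup∘tabulate _ (fromℕ< x<N) ⟩
    P (toℕ (fromℕ< x<N))            ≡⟨ cong P (toℕ-fromℕ< x<N) ⟩
    P x                             ∎))
    where open ≡-Reasoning

Avoids : (N t : ℕ) .{{_ : NonZero N}} → (ℕ → Bool) → Set
Avoids N t P = ∀ v → v < N → T (P v) → ¬ T (P ((v + t) % N))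

Avoids-% : ∀ {D N t Q} .{{_ : NonZero D}} .{{_ : NonZero N}} → D ∣ N → Avoids D t Q → Avoids N t (Q ∘ (_% D))
Avoids-% {D} {N} {t} {Q} D∣N avoids v _ Qv Q[v+t] = avoids (v % D) (m%n<n v D) Qv (subst (T ∘ Q) reduce Q[v+t])
  where
  reduce : (v + t) % N % D ≡ (v % D + t) % D
  reduce = trans (m∣n⇒o%n%m≡o%m D N (v + t) D∣N) (%-absorbˡ-+ v t D)

module _ (n d : ℕ) .{{_ : NonZero (d ^ n)}} where

  private
    N = d ^ n

  Step : Fin N → Fin N → Set
  Step u w = Σ ℕ λ i → i < n × toℕ w ≡ (toℕ u + d ^ i) % N

  step⇒adjacent : ∀ {u w} → Step u w → RCAdj n d w u
  step⇒adjacent {u} {w} (i , i<n , w≡u+t) =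
    i , i<n , inj₁ (subst (λ x → ℤ.+ N ℤ.∣ (ℤ.+ x ℤ.- ℤ.+ toℕ u) ℤ.- ℤ.+ (d ^ i)) (sym w≡u+t)
                          (∣[[m+t]%N-m]-t (toℕ u) (d ^ i) N))

  adjacent⇒step : ∀ {u w} → RCAdj n d u w → Step w u ⊎ Step u w
  adjacent⇒step {u} {w} (i , i<n , inj₁ N∣u-w-t) =
    inj₁ (i , i<n , ∣[a-b]-t⇒a≡[b+t]%N (toℕ u) (toℕ w) (d ^ i) (toℕ<n u) N∣u-w-t)
  adjacent⇒step {u} {w} (i , i<n , inj₂ N∣u-w+t) =
    inj₂ (i , i<n , ∣[a-b]+t⇒b≡[a+t]%N (toℕ u) (toℕ w) (d ^ i) (toℕ<n w) N∣u-w+t)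

  independent⇒χ-step≤1 : ∀ {S} → Independent (RCAdj n d) S → ∀ {i} → i < n → ∀ y → χ S y + χ S (y + d ^ i) ≤ 1
  independent⇒χ-step≤1 {S} indep {i} i<n y =
    𝟙-exclusive λ y∈S y+t∈S → indep w u (χ-member S y+t∈S) (χ-member S y∈S) (step⇒adjacent (i , i<n , w≡u+t))
    where
    open ≡-Reasoning
    u w : Fin N
    u = fromℕ< (m%n<n y N)
    w = fromℕ< (m%n<n (y + d ^ i) N)
    w≡u+t : toℕ w ≡ (toℕ u + d ^ i) % N
    w≡u+t = begin
      toℕ w                ≡⟨ toℕ-fromℕ< _ ⟩
      (y + d ^ i) % N      ≡⟨ %-absorbˡ-+ y (d ^ i) N ⟩
      (y % N + d ^ i) % N  ≡⟨ cong (λ x → (x + d ^ i) % N) (toℕ-fromℕ< _) ⟨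
      (toℕ u + d ^ i) % N  ∎

  independent⇒oddCycle-bound : ∀ {S} → Independent (RCAdj n d) S → ∀ {i} → i < n → ∀ k →
                               (∀ y → χ S y + χ S (y + (k + k) * d ^ i) ≤ 1) → suc (k + k) * ∣ S ∣ ≤ N * k
  independent⇒oddCycle-bound {S} indep i<n k closing =
    subst (λ s → suc (k + k) * s ≤ N * k) (sym (∣S∣≡∑χ S))
      (∑-periodic-oddCycles N _ k (χ S) (χ-periodic S) (independent⇒χ-step≤1 indep i<n) closing)

  select-independent : ∀ P → (∀ {i} → i < n → Avoids N (d ^ i) P) → Independent (RCAdj n d) (select P)
  select-independent P avoids u w u∈ w∈ = [ no-step w∈ u∈ , no-step u∈ w∈ ]′ ∘ adjacent⇒step
    where
    no-step : ∀ {a b} → a ∈ select P → b ∈ select P → ¬ Step a b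
    no-step {a} a∈ b∈ (i , i<n , b≡a+t) =
      avoids i<n (toℕ a) (toℕ<n a) (∈-select P a∈) (subst (T ∘ P) b≡a+t (∈-select P b∈))

  independence-number : ∀ P {α} → (∀ {i} → i < n → Avoids N (d ^ i) P) → ∑[ x < N ] 𝟙 (P x) ≡ α →
                        (∀ S → Independent (RCAdj n d) S → ∣ S ∣ ≤ α) → IsIndependenceNumber (RCAdj n d) α
  independence-number P avoids ∑P≡α upper = (select P , select-independent P avoids , trans (∣select∣ P) ∑P≡α) , upper

-- Odd degree d = 2e + 1

module OddDegree (e : ℕ) where

  d N α M : ℕ
  d = suc (e + e)
  N = d ^ 2
  α = e * d
  M = α + α

  N≡M+d : N ≡ M + d
  N≡M+d = ring e
    where
    ring : ∀ e → suc (e + e) * (suc (e + e) * 1) ≡ e * suc (e + e) + e * suc (e + e) + suc (e + e)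
    ring = solve-∀

  d²≡d+2α : d ^ 2 ≡ d + α * 2
  d²≡d+2α = ring e
    where
    ring : ∀ e → suc (e + e) * (suc (e + e) * 1) ≡ suc (e + e) + e * suc (e + e) * 2
    ring = solve-∀

  -- Both steps are odd and never wrap around from below M = d² − d, so they change parity.
  selector : ℕ → Bool
  selector v = not (oddᵇ v) ∧ (v <ᵇ M)

  selected-even : ∀ v → T (selector v) → T (not (oddᵇ v))
  selected-even v = proj₁ ∘ Equivalence.to (T-∧ {not (oddᵇ v)})

  selected-< : ∀ v → T (selector v) → v < M
  selected-< v = <ᵇ⇒< v M ∘ proj₂ ∘ Equivalence.to (T-∧ {not (oddᵇ v)})

  avoids-odd-step : ∀ t → t ≤ d → oddᵇ t ≡ true → Avoids N t selector
  avoids-odd-step t t≤d odd-t v v<N sel-v sel-w =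
    T⇒¬T-not (selected-even v sel-v) (subst (T ∘ not) oddᵇ[v+t] (selected-even _ sel-w))
    where
    v+t<N : v + t < N
    v+t<N = subst (v + t <_) (sym N≡M+d) (+-mono-<-≤ (selected-< v sel-v) t≤d)
    oddᵇ[v+t] : oddᵇ ((v + t) % N) ≡ not (oddᵇ v)
    oddᵇ[v+t] = begin
      oddᵇ ((v + t) % N)   ≡⟨ cong oddᵇ (m<n⇒m%n≡m v+t<N) ⟩
      oddᵇ (v + t)         ≡⟨ cong oddᵇ (+-comm v t) ⟩
      oddᵇ (t + v)         ≡⟨ oddᵇ-+ t v ⟩
      oddᵇ t xor oddᵇ v    ≡⟨ cong (_xor oddᵇ v) odd-t ⟩
      not (oddᵇ v)         ∎
      where open ≡-Reasoning

  avoids-steps : ∀ {i} → i < 2 → Avoids N (d ^ i) selector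
  avoids-steps {zero}        _ = avoids-odd-step 1 (s≤s z≤n) refl
  avoids-steps {suc zero}    _ = avoids-odd-step (d * 1) (≤-reflexive (*-identityʳ d))
                                   (trans (cong oddᵇ (*-identityʳ d)) (cong not (oddᵇ-double e)))
  avoids-steps {suc (suc _)} (s≤s (s≤s ()))

  ∑selector : ∑[ x < N ] 𝟙 (selector x) ≡ α
  ∑selector = begin
    ∑[ x < N ] 𝟙 (selector x)                                     ≡⟨ cong (λ n → ∑[ x < n ] 𝟙 (selector x)) N≡M+d ⟩
    ∑[ x < M + d ] 𝟙 (selector x)                                 ≡⟨ ∑-split M d _ ⟩
    ∑[ x < M ] 𝟙 (selector x) + ∑[ x < d ] 𝟙 (selector (M + x))  ≡⟨ cong₂ _+_ (∑-cong M below) (∑-cong d above) ⟩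
    ∑[ x < M ] 𝟙 (not (oddᵇ x)) + ∑[ _ < d ] 0                    ≡⟨ cong₂ _+_ (∑-evens α) (∑-const d 0) ⟩
    α + d * 0                                                     ≡⟨ cong (α +_) (*-zeroʳ d) ⟩
    α + 0                                                         ≡⟨ +-identityʳ α ⟩
    α                                                             ∎
    where
    open ≡-Reasoning
    below : ∀ x → x < M → 𝟙 (selector x) ≡ 𝟙 (not (oddᵇ x))
    below x x<M = cong 𝟙 (trans (cong (not (oddᵇ x) ∧_) (dec-true (x <? M) x<M)) (∧-identityʳ _))
    above : ∀ x → x < d → 𝟙 (selector (M + x)) ≡ 0
    above x _ = cong 𝟙 (trans (cong (not (oddᵇ (M + x)) ∧_) (dec-false (M + x <? M) (m+n≮m M x))) (∧-zeroʳ _))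

  -- The odd cycle y, y + d, …, y + 2ed is closed by the step d from y + 2ed to y + d².
  upper-bound : ∀ S → Independent (RCAdj 2 d) S → ∣ S ∣ ≤ α
  upper-bound S indep = ≤-from-scaled-bound d (independent⇒oddCycle-bound 2 d indep 1<2 e closing)
                          (≤-trans (s≤s (m≤n+m _ (e + e))) (≤-reflexive (sym (ring e))))
    where
    1<2 : 1 < 2
    1<2 = s≤s (s≤s z≤n)
    wrap : ∀ y e → y + (e + e) * (suc (e + e) * 1) + suc (e + e) * 1 ≡ y + suc (e + e) * (suc (e + e) * 1)
    wrap = solve-∀
    closing : ∀ y → χ S y + χ S (y + (e + e) * d ^ 1) ≤ 1
    closing y = subst (_≤ 1) (trans (cong (χ S y′ +_) (trans (cong (χ S) (wrap y e)) (χ-periodic S y)))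
                                    (+-comm (χ S y′) (χ S y)))
                  (independent⇒χ-step≤1 2 d indep 1<2 y′)
      where
      y′ = y + (e + e) * d ^ 1
    ring : ∀ e → suc (e + e) * suc (e * suc (e + e)) ≡ suc (e + e + suc (e + e) * (suc (e + e) * 1) * e)
    ring = solve-∀

  isIndependenceNumber : IsIndependenceNumber (RCAdj 2 d) α
  isIndependenceNumber = independence-number 2 d selector avoids-steps ∑selector upper-bound

-- Even degree d = 2e

module EvenDegree (f : ℕ) where

  e d D N α : ℕ
  e = suc f
  d = e + e
  D = d + d
  N = d ^ 2
  α = e * (e + f)

  d²≡d+2α : d ^ 2 ≡ d + α * 2
  d²≡d+2α = ring f
    where
    ring : ∀ f → (suc f + suc f) * ((suc f + suc f) * 1) ≡ (suc f + suc f) + suc f * (suc f + f) * 2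
    ring = solve-∀

  N≡e*D : N ≡ e * D
  N≡e*D = ring f
    where
    ring : ∀ f → (suc f + suc f) * ((suc f + suc f) * 1) ≡ suc f * ((suc f + suc f) + (suc f + suc f))
    ring = solve-∀

  oddᵇ-d+ : ∀ x → oddᵇ (d + x) ≡ oddᵇ x
  oddᵇ-d+ x = trans (oddᵇ-+ d x) (cong (_xor oddᵇ x) (oddᵇ-double e))

  -- Read the residues modulo D = 2d as two rows of length d. The colour flips along both steps,
  -- except along d − 1 → d, whose ends are both uncoloured, and along D − 1 → 0, hence the removal of D − 1.
  colour : ℕ → Bool
  colour r = oddᵇ r xor (r <ᵇ d)

  colour-flipˡ : ∀ v w → oddᵇ w ≡ not (oddᵇ v) → (w <ᵇ d) ≡ (v <ᵇ d) → colour w ≡ not (colour v)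
  colour-flipˡ v w p q = trans (cong₂ _xor_ p q) (sym (not-distribˡ-xor (oddᵇ v) (v <ᵇ d)))

  colour-flipʳ : ∀ v w → oddᵇ w ≡ oddᵇ v → (w <ᵇ d) ≡ not (v <ᵇ d) → colour w ≡ not (colour v)
  colour-flipʳ v w p q = trans (cong₂ _xor_ p q) (sym (not-distribʳ-xor (oddᵇ v) (v <ᵇ d)))

  residueSelector : ℕ → Bool
  residueSelector r = colour r ∧ not (suc r ≡ᵇ D)

  selected-colour : ∀ r → T (residueSelector r) → T (colour r)
  selected-colour r = proj₁ ∘ Equivalence.to (T-∧ {colour r})

  selected-<D : ∀ r → r < D → T (residueSelector r) → suc r < D
  selected-<D r r<D sel =
    ≤∧≢⇒< r<D λ eq → T⇒¬T-not (≡⇒≡ᵇ (suc r) D eq) (proj₂ (Equivalence.to (T-∧ {colour r}) sel))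

  ¬both-selected : ∀ v w → colour w ≡ not (colour v) → T (residueSelector v) → T (residueSelector w) → ⊥
  ¬both-selected v w flip sel-v sel-w = T⇒¬T-not (selected-colour v sel-v) (subst T flip (selected-colour w sel-w))

  avoids-1 : Avoids D 1 residueSelector
  avoids-1 v v<D sel-v sel-w =
    ¬both-selected v (suc v) (colour-flipˡ v (suc v) refl same-half) sel-v
      (subst (T ∘ residueSelector) v+1%D≡1+v sel-w)
    where
    1+v<D = selected-<D v v<D sel-v
    v+1%D≡1+v : (v + 1) % D ≡ suc v
    v+1%D≡1+v = trans (cong (_% D) (+-comm v 1)) (m<n⇒m%n≡m 1+v<D)
    same-half : (suc v <ᵇ d) ≡ (v <ᵇ d)
    same-half with suc v <? d | v <? d
    ... | yes 1+v<d | _       = trans (dec-true (suc v <? d) 1+v<d) (sym (dec-true (v <? d) (<-trans ≤-refl 1+v<d)))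
    ... | no 1+v≮d  | no v≮d  = trans (dec-false (suc v <? d) 1+v≮d) (sym (dec-false (v <? d) v≮d))
    ... | no 1+v≮d  | yes v<d = ⊥-elim (subst T colour-v (selected-colour v sel-v))
      where
      open ≡-Reasoning
      colour-v : colour v ≡ false
      colour-v = begin
        oddᵇ v xor (v <ᵇ d)          ≡⟨ cong₂ _xor_ (not-involutive (oddᵇ v)) (sym (dec-true (v <? d) v<d)) ⟨
        not (oddᵇ (suc v)) xor true  ≡⟨ cong (λ x → not (oddᵇ x) xor true) (≤∧≮⇒≡ v<d 1+v≮d) ⟩
        not (oddᵇ d) xor true        ≡⟨ cong (λ b → not b xor true) (oddᵇ-double e) ⟩
        false                        ∎

  avoids-d : Avoids D d residueSelector
  avoids-d v v<D sel-v sel-w with v <? d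
  ... | yes v<d = ¬both-selected v (v + d) (colour-flipʳ v (v + d) oddᵇ-same half-flip) sel-v
                    (subst (T ∘ residueSelector) (m<n⇒m%n≡m (+-monoˡ-< d v<d)) sel-w)
    where
    oddᵇ-same : oddᵇ (v + d) ≡ oddᵇ v
    oddᵇ-same = trans (cong oddᵇ (+-comm v d)) (oddᵇ-d+ v)
    half-flip : (v + d <ᵇ d) ≡ not (v <ᵇ d)
    half-flip = trans (dec-false (v + d <? d) (m+n≮n v d)) (cong not (sym (dec-true (v <? d) v<d)))
  ... | no v≮d  = ¬both-selected v s (colour-flipʳ v s oddᵇ-same half-flip) sel-v
                    (subst (T ∘ residueSelector) [v+d]%D≡s sel-w)
    where
    s = v ∸ d
    d+s≡v : d + s ≡ v
    d+s≡v = m+[n∸m]≡n (≮⇒≥ v≮d)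
    s<d : s < d
    s<d = +-cancelˡ-< d s d (subst (_< D) (sym d+s≡v) v<D)
    [v+d]%D≡s : (v + d) % D ≡ s
    [v+d]%D≡s = begin
      (v + d) % D       ≡⟨ cong (λ x → (x + d) % D) d+s≡v ⟨
      (d + s + d) % D   ≡⟨ cong (_% D) (rotate d s) ⟩
      (s + D) % D       ≡⟨ [m+n]%n≡m%n s D ⟩
      s % D             ≡⟨ m<n⇒m%n≡m (<-≤-trans s<d (m≤m+n d d)) ⟩
      s                 ∎
      where
      open ≡-Reasoning
      rotate : ∀ d s → d + s + d ≡ s + (d + d)
      rotate = solve-∀
    oddᵇ-same : oddᵇ s ≡ oddᵇ v
    oddᵇ-same = trans (sym (oddᵇ-d+ s)) (cong oddᵇ d+s≡v)
    half-flip : (s <ᵇ d) ≡ not (v <ᵇ d)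
    half-flip = trans (dec-true (s <? d) s<d) (cong not (sym (dec-false (v <? d) v≮d)))

  selector : ℕ → Bool
  selector v = residueSelector (v % D)

  avoids-steps : ∀ {i} → i < 2 → Avoids N (d ^ i) selector
  avoids-steps {zero}        _ = Avoids-% (divides e N≡e*D) avoids-1
  avoids-steps {suc zero}    _ = subst (λ t → Avoids N t selector) (sym (*-identityʳ d))
                                   (Avoids-% (divides e N≡e*D) avoids-d)
  avoids-steps {suc (suc _)} (s≤s (s≤s ()))

  lower-half : ∀ x → x < d → residueSelector x ≡ not (oddᵇ x)
  lower-half x x<d = begin
    (oddᵇ x xor (x <ᵇ d)) ∧ not (suc x ≡ᵇ D)
      ≡⟨ cong₂ (λ b c → (oddᵇ x xor b) ∧ not c) (dec-true (x <? d) x<d) (dec-false (suc x ≟ D) 1+x≢D) ⟩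
    (oddᵇ x xor true) ∧ true
      ≡⟨ ∧-identityʳ _ ⟩
    oddᵇ x xor true
      ≡⟨ xor-comm (oddᵇ x) true ⟩
    not (oddᵇ x) ∎
    where
    open ≡-Reasoning
    1+x≢D : suc x ≢ D
    1+x≢D = <⇒≢ (<-≤-trans (s≤s x<d) (m<m+n d z<s))

  d≡2+f+f : d ≡ suc (suc (f + f))
  d≡2+f+f = cong suc (+-suc f f)

  upper-half : ∀ x → x < suc (f + f) → residueSelector (d + x) ≡ oddᵇ x
  upper-half x x<1+2f = begin
    (oddᵇ (d + x) xor (d + x <ᵇ d)) ∧ not (suc (d + x) ≡ᵇ D)
      ≡⟨ cong₂ (λ b c → (b xor c) ∧ not (suc (d + x) ≡ᵇ D)) (oddᵇ-d+ x) (dec-false (d + x <? d) (m+n≮m d x)) ⟩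
    (oddᵇ x xor false) ∧ not (suc (d + x) ≡ᵇ D)
      ≡⟨ cong₂ (λ b c → b ∧ not c) (xor-identityʳ (oddᵇ x)) (dec-false (suc (d + x) ≟ D) (<⇒≢ 1+d+x<D)) ⟩
    oddᵇ x ∧ true
      ≡⟨ ∧-identityʳ (oddᵇ x) ⟩
    oddᵇ x ∎
    where
    open ≡-Reasoning
    1+d+x<D : suc (d + x) < D
    1+d+x<D = subst (_< D) (+-suc d x) (+-monoʳ-< d (subst (suc x <_) (sym d≡2+f+f) (s≤s x<1+2f)))

  upper-half-last : residueSelector (d + suc (f + f)) ≡ false
  upper-half-last = trans (cong (colour (d + suc (f + f)) ∧_) (cong not (dec-true (suc (d + suc (f + f)) ≟ D) wraps)))
                          (∧-zeroʳ _)
    where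
    wraps : suc (d + suc (f + f)) ≡ D
    wraps = trans (sym (+-suc d (suc (f + f)))) (cong (d +_) (sym d≡2+f+f))

  ∑upper-half : ∑[ x < d ] 𝟙 (residueSelector (d + x)) ≡ f
  ∑upper-half = begin
    ∑[ x < d ] g x                                ≡⟨ cong (λ n → ∑< n g) d≡2+f+f ⟩
    ∑[ x < suc (suc (f + f)) ] g x                ≡⟨ ∑-last (suc (f + f)) g ⟩
    ∑[ x < suc (f + f) ] g x + g (suc (f + f))    ≡⟨ cong₂ _+_ (∑-cong (suc (f + f)) λ x x< → cong 𝟙 (upper-half x x<))
                                                               (cong 𝟙 upper-half-last) ⟩
    ∑[ x < suc (f + f) ] 𝟙 (oddᵇ x) + 0           ≡⟨ +-identityʳ _ ⟩
    ∑[ x < suc (f + f) ] 𝟙 (oddᵇ x)               ≡⟨ ∑-last (f + f) _ ⟩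
    ∑[ x < f + f ] 𝟙 (oddᵇ x) + 𝟙 (oddᵇ (f + f))  ≡⟨ cong₂ _+_ (∑-odds f) (cong 𝟙 (oddᵇ-double f)) ⟩
    f + 0                                         ≡⟨ +-identityʳ f ⟩
    f                                             ∎
    where
    open ≡-Reasoning
    g : ℕ → ℕ
    g x = 𝟙 (residueSelector (d + x))

  ∑residueSelector : ∑[ r < D ] 𝟙 (residueSelector r) ≡ e + f
  ∑residueSelector = trans (∑-split d d (𝟙 ∘ residueSelector))
    (cong₂ _+_ (trans (∑-cong d λ x x<d → cong 𝟙 (lower-half x x<d)) (∑-evens e)) ∑upper-half)

  ∑selector : ∑[ x < N ] 𝟙 (selector x) ≡ α
  ∑selector = begin
    ∑[ x < N ] 𝟙 (selector x)             ≡⟨ cong (λ n → ∑[ x < n ] 𝟙 (selector x)) N≡e*D ⟩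
    ∑[ x < e * D ] 𝟙 (selector x)         ≡⟨ ∑-periodic e D _ periodic ⟩
    e * ∑[ x < D ] 𝟙 (selector x)         ≡⟨ cong (e *_) (∑-cong D λ x x<D → cong (𝟙 ∘ residueSelector)
                                                                                 (m<n⇒m%n≡m x<D)) ⟩
    e * ∑[ r < D ] 𝟙 (residueSelector r)  ≡⟨ cong (e *_) ∑residueSelector ⟩
    α                                     ∎
    where
    open ≡-Reasoning
    periodic : ∀ y → 𝟙 (selector (D + y)) ≡ 𝟙 (selector y)
    periodic y = cong (𝟙 ∘ residueSelector) (trans (cong (_% D) (+-comm D y)) ([m+n]%n≡m%n y D))

  -- The odd cycle y, y + 1, …, y + d is closed by the step d itself.
  upper-bound : ∀ S → Independent (RCAdj 2 d) S → ∣ S ∣ ≤ α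
  upper-bound S indep = ≤-from-scaled-bound (suc d) (independent⇒oddCycle-bound 2 d indep 0<2 e closing)
                          (≤-trans (s≤s (m≤n+m _ e)) (≤-reflexive (sym (ring f))))
    where
    0<2 : 0 < 2
    0<2 = s≤s z≤n
    1<2 : 1 < 2
    1<2 = s≤s (s≤s z≤n)
    closing : ∀ y → χ S y + χ S (y + (e + e) * d ^ 0) ≤ 1
    closing = independent⇒χ-step≤1 2 d indep 1<2
    ring : ∀ f → suc (suc f + suc f) * suc (suc f * (suc f + f))
               ≡ suc (suc f + (suc f + suc f) * ((suc f + suc f) * 1) * suc f)
    ring = solve-∀

  isIndependenceNumber : IsIndependenceNumber (RCAdj 2 d) α
  isIndependenceNumber = independence-number 2 d selector avoids-steps ∑selector upper-bound

half-of-d²∸d : ∀ d α → d ^ 2 ≡ d + α * 2 → (d ^ 2 ∸ d) / 2 ≡ α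
half-of-d²∸d d α d²≡d+2α = begin
  (d ^ 2 ∸ d) / 2      ≡⟨ cong (λ m → (m ∸ d) / 2) d²≡d+2α ⟩
  (d + α * 2 ∸ d) / 2  ≡⟨ cong (_/ 2) (m+n∸m≡n d (α * 2)) ⟩
  α * 2 / 2            ≡⟨ m*n/n≡m α 2 ⟩
  α                    ∎
  where open ≡-Reasoning

independenceNumber-G[d²,d] : ∀ d → 0 < d → IsIndependenceNumber (RCAdj 2 d) ((d ^ 2 ∸ d) / 2)
independenceNumber-G[d²,d] d 0<d with halves d
... | even zero    = ⊥-elim (n≮0 0<d)
... | even (suc f) = subst (IsIndependenceNumber (RCAdj 2 _)) (sym (half-of-d²∸d _ α d²≡d+2α)) isIndependenceNumber
  where open EvenDegree f using (α; d²≡d+2α; isIndependenceNumber)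
... | odd e        = subst (IsIndependenceNumber (RCAdj 2 _)) (sym (half-of-d²∸d _ α d²≡d+2α)) isIndependenceNumber
  where open OddDegree e using (α; d²≡d+2α; isIndependenceNumber)

lemma4p14 : (d : ℕ) → 3 ≤ d →
    IsIndependenceNumber (RCAdj 2 d) ((d ^ 2 ∸ d) / 2)
lemma4p14 d 3≤d = independenceNumber-G[d²,d] d (<-≤-trans (s≤s z≤n) 3≤d)
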